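{- Let $\Gamma$ be a finite tree with vertex set $X$, let $x_0\in X$ be a base vertex, and let $T=T(x_0)$ be the Terwilliger algebra of $\Gamma$ with respect to $x_0$. Let $H=\mathrm{Aut}(\Gamma^{(x_0)})$ be the group of automorphisms of $\Gamma$ fixing $x_0$, and let $\mathrm{Orb}(H,X)$ denote the set of $H$-orbits on $X$. Then the principal $T$-module $W_0=Tx_0$ satisfies $$W_0=\mathrm{Span}\{\underline{Y}\mid Y\in \mathrm{Orb}(H,X)\},$$ where $\underline{Y}=\sum_{y\in Y} y\in V$.
   Context: For a finite connected simple graph $\Gamma$ with vertex set $X$ and a fixed base vertex $x_0\in X$, let $\partial$ be the graph distance, $D=\max\{\partial(x_0,x)\mid x\in X\}$, and $X_i=\{x\in X\mid \partial(x_0,x)=i\}$ for $0\le i\le D$. The standard module is $V=\mathbb{C}X$, the complex vector space with basis $X$, equipped with the Hermitian form making $X$ orthonormal. Let $A$ be the adjacency matrix of $\Gamma$ acting on $V$, and $E_i^*$ the orthogonal projection of $V$ onto $V_i^*=\mathbb{C}X_i$. The Terwilliger algebra $T=T(x_0)$ is the subalgebra of $\mathrm{End}(V)$ generated by $A$ and $E_0^*,\dots,E_D^*$. The principal $T$-module is $W_0=Tx_0$, the smallest $T$-submodule of $V$ containing $x_0$. $\Gamma^{(x_0)}$ denotes $\Gamma$ regarded as a rooted tree with root $x_0$. -}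

module Defs where

open import Level using (Level; _⊔_) renaming (suc to lsuc)
open import Data.Nat using (ℕ; zero; suc; _<_)
open import Data.Fin using (Fin)
import Data.Fin as Fin
open import Data.Bool using (Bool; true; false)
open import Data.List using (List; []; _∷_)
open import Data.List.Relation.Unary.Unique.Propositional using (Unique)
open import Data.Product using (Σ; ∃; _×_; _,_)
open import Relation.Nullary using (¬_)
open import Relation.Binary.PropositionalEquality using (_≡_)
open import Function.Bundles using (_↔_; Inverse)
open import Algebra.Bundles using (CommutativeRing)

record SimpleGraph (n : ℕ) : Set where
  field
    adj     : Fin n → Fin n → Bool
    symm    : ∀ x y → adj x y ≡ adj y x
    irrefl  : ∀ x → adj x x ≡ false

module _ {n : ℕ} (Γ : SimpleGraph n) where
  open SimpleGraph Γ

  Adj : Fin n → Fin n → Set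
  Adj x y = adj x y ≡ true

  data Walk : Fin n → Fin n → ℕ → Set where
    here : ∀ x → Walk x x zero
    step : ∀ {x y z k} → Adj x y → Walk y z k → Walk x z (suc k)

  Dist : Fin n → Fin n → ℕ → Set
  Dist x y i = Walk x y i × (∀ j → j < i → ¬ Walk x y j)

  Connected : Set
  Connected = ∀ x y → ∃ λ k → Walk x y k

  data IsWalkList : Fin n → Fin n → List (Fin n) → Set where
    one  : ∀ x → IsWalkList x x (x ∷ [])
    cons : ∀ {x y z ps} → Adj x y → IsWalkList y z (y ∷ ps) →
           IsWalkList x z (x ∷ y ∷ ps)

  IsPath : Fin n → Fin n → List (Fin n) → Set
  IsPath x y ps = IsWalkList x y ps × Unique ps

  IsTree : Set
  IsTree = Connected × (∀ x y ps qs → IsPath x y ps → IsPath x y qs → ps ≡ qs)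

  record RootedAut (x₀ : Fin n) : Set where
    field
      perm     : Fin n ↔ Fin n
      preserve : ∀ x y → adj (Inverse.to perm x) (Inverse.to perm y) ≡ adj x y
      fixRoot  : Inverse.to perm x₀ ≡ x₀

  SameOrbit : Fin n → Fin n → Fin n → Set
  SameOrbit x₀ x y = Σ (RootedAut x₀) λ h → Inverse.to (RootedAut.perm h) x ≡ y

-- Fields of characteristic zero (the paper works over ℂ)

ofℕ : ∀ {c ℓ} (R : CommutativeRing c ℓ) → ℕ → CommutativeRing.Carrier R
ofℕ R zero    = CommutativeRing.0# R
ofℕ R (suc m) = CommutativeRing._+_ R (CommutativeRing.1# R) (ofℕ R m)

record CharZeroField c ℓ : Set (lsuc (c ⊔ ℓ)) where
  field
    commRing : CommutativeRing c ℓ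
  open CommutativeRing commRing public hiding (ring)
  field
    nontrivial : ¬ (1# ≈ 0#)
    inverse    : ∀ x → ¬ (x ≈ 0#) → ∃ λ y → x * y ≈ 1#
    charZero   : ∀ m → ¬ (ofℕ commRing (suc m) ≈ 0#)

-- The standard module V = K^X (vectors are functions Fin n → K)

module Standard {c ℓ} (K : CharZeroField c ℓ) where
  open CharZeroField K

  Vec : ℕ → Set c
  Vec n = Fin n → Carrier

  ∑ : ∀ {m} → (Fin m → Carrier) → Carrier
  ∑ {zero}  f = 0#
  ∑ {suc m} f = f Fin.zero + ∑ (λ i → f (Fin.suc i))

  [_] : Bool → Carrier
  [ true ]  = 1#
  [ false ] = 0#

  module _ {n : ℕ} (Γ : SimpleGraph n) (x₀ : Fin n) where
    open SimpleGraph Γ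

    IsBasisVec : Fin n → Vec n → Set ℓ
    IsBasisVec x v = ∀ y → (y ≡ x → v y ≈ 1#) × (¬ (y ≡ x) → v y ≈ 0#)

    Aₘ : Vec n → Vec n
    Aₘ u y = ∑ (λ z → [ adj y z ] * u z)

    IsEStar : ℕ → Vec n → Vec n → Set ℓ
    IsEStar i u w = ∀ y → (Dist Γ x₀ y i → w y ≈ u y) × (¬ Dist Γ x₀ y i → w y ≈ 0#)

    -- W₀ = T x₀ : the smallest subspace containing x₀ and closed under
    -- A and all E_i^* (these generate T, which contains I = Σ E_i^*)
    data InW₀ : Vec n → Set (c ⊔ ℓ) where
      base  : ∀ v → IsBasisVec x₀ v → InW₀ v
      zero∈ : InW₀ (λ _ → 0#)
      add   : ∀ {u v} → InW₀ u → InW₀ v → InW₀ (λ y → u y + v y)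
      scale : ∀ a {u} → InW₀ u → InW₀ (λ y → a * u y)
      applyA : ∀ {u} → InW₀ u → InW₀ (Aₘ u)
      applyE : ∀ i {u w} → InW₀ u → IsEStar i u w → InW₀ w
      resp  : ∀ {u v} → InW₀ u → (∀ y → u y ≈ v y) → InW₀ v

    IsOrbitVec : Fin n → Vec n → Set ℓ
    IsOrbitVec x v = ∀ y → (SameOrbit Γ x₀ x y → v y ≈ 1#) × (¬ SameOrbit Γ x₀ x y → v y ≈ 0#)

    -- Span{ \underline{Y} | Y ∈ Orb(H, X) }  (every orbit is the orbit of some x)
    data InOrbitSpan : Vec n → Set (c ⊔ ℓ) where
      gen   : ∀ x v → IsOrbitVec x v → InOrbitSpan v
      zero∈ : InOrbitSpan (λ _ → 0#)
      add   : ∀ {u v} → InOrbitSpan u → InOrbitSpan v → InOrbitSpan (λ y → u y + v y)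
      scale : ∀ a {u} → InOrbitSpan u → InOrbitSpan (λ y → a * u y)
      resp  : ∀ {u v} → InOrbitSpan u → (∀ y → u y ≈ v y) → InOrbitSpan v

-- W₀ consists of H-invariant vectors, since x₀, A and the E*ᵢ are H-invariant. Conversely,
-- put x and y in the same class when x ≅ y (equal depth, isomorphic rooted subtrees),
-- parent x ≅ parent y, and so on up to the root. Such vertices lie in the same H-orbit:
-- descending from the root, swap isomorphic sibling subtrees. The class vector of x is A
-- applied to that of parent x, multiplied by the indicator of {y | y ≅ x}, and multiplying
-- by this indicator preserves W₀: by induction on the height, the number of children of y in
-- a given ≅-class is produced by the operators E*ᵢ A (g ·) E*ᵢ₊₁ A E*ᵢ, and in characteristic 0
-- the indicator of a value of a bounded count is a polynomial in it. Hence class vectors are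
-- the orbit vectors, and every invariant v equals Σₓ (v x / |class of x|) · classVec x.

module Submission where

open import Defs
open import Data.Bool using (Bool; true; false; _∧_; if_then_else_)
import Data.Bool.Properties as Boolₚ
open import Data.Empty using (⊥-elim)
open import Data.Fin using (Fin; zero; suc; toℕ; fromℕ<; punchIn)
import Data.Fin.Properties as Finₚ
open import Data.List using (List; []; _∷_; length)
open import Data.List.Relation.Unary.All as All using (All; []; _∷_)
open import Data.List.Relation.Unary.AllPairs using ([]; _∷_)
open import Data.List.Relation.Unary.Unique.Propositional using (Unique)
open import Data.Maybe using (Maybe; just; nothing; fromMaybe)
import Data.Maybe as Maybe
open import Data.Nat using (ℕ; zero; suc; _⊔_; _<_; _≤_; z≤n; s≤s; s≤s⁻¹)
open import Data.Nat.Induction using (<-wellFounded)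
import Data.Nat.Properties as ℕₚ
open import Data.Product using (Σ; ∃; _×_; _,_; proj₁; proj₂)
open import Data.Sum using (_⊎_; inj₁; inj₂)
open import Function.Base using (_∘_; id)
open import Function.Bundles using (Inverse; mk↔ₛ′)
open import Induction.WellFounded using (Acc; acc)
open import Level using () renaming (_⊔_ to _⊔ˡ_)
open import Relation.Binary using (tri<; tri≈; tri>)
open import Relation.Binary.PropositionalEquality
  using (_≡_; _≢_; refl; sym; trans; cong; cong₂; subst; subst₂; module ≡-Reasoning)
open import Relation.Nullary using (¬_; Dec; yes; no; does; ¬?; _×-dec_; contradiction)
open import Relation.Nullary.Decidable using (dec-true; map′)

does⇒ : ∀ {a} {A : Set a} (a? : Dec A) → does a? ≡ true → A
does⇒ (yes a) _ = a

∧-true⇒ˡ : ∀ {a b} → a ∧ b ≡ true → a ≡ true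
∧-true⇒ˡ {true} _ = refl

∧-true⇒ʳ : ∀ {a b} → a ∧ b ≡ true → b ≡ true
∧-true⇒ʳ {true} p = p

∧-true : ∀ {a b} → a ≡ true → b ≡ true → a ∧ b ≡ true
∧-true refl p = p

maximum : ∀ {m} → (Fin m → ℕ) → ℕ
maximum {zero}  f = 0
maximum {suc m} f = f zero ⊔ maximum (f ∘ suc)

maximum-upper : ∀ {m} (f : Fin m → ℕ) i → f i ≤ maximum f
maximum-upper f zero    = ℕₚ.m≤m⊔n _ _
maximum-upper f (suc i) = ℕₚ.≤-trans (maximum-upper (f ∘ suc) i) (ℕₚ.m≤n⊔m _ _)

module BoolEquivalence {a} {A : Set a} (R : A → A → Bool)
  (R-sym : ∀ {x y} → R x y ≡ true → R y x ≡ true)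
  (R-trans : ∀ {x y z} → R x y ≡ true → R y z ≡ true → R x z ≡ true) where

  comm : ∀ x y → R x y ≡ R y x
  comm x y with R x y in xy | R y x in yx
  ... | true  | true  = refl
  ... | false | false = refl
  ... | true  | false = trans (sym (R-sym xy)) yx
  ... | false | true  = trans (sym xy) (R-sym yx)

  respˡ : ∀ {x y} → R x y ≡ true → ∀ w → R x w ≡ R y w
  respˡ {x} {y} xy w with R x w in xw | R y w in yw
  ... | true  | true  = refl
  ... | false | false = refl
  ... | true  | false = trans (sym (R-trans (R-sym xy) xw)) yw
  ... | false | true  = trans (sym xw) (R-trans xy yw)

  respʳ : ∀ {x y} → R x y ≡ true → ∀ w → R w x ≡ R w y
  respʳ {x} {y} xy w = trans (comm w x) (trans (respˡ xy w) (comm y w))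

module Counting where
  open import Data.Nat using (_+_; _<ᵇ_)

  bit : Bool → ℕ
  bit b = if b then 1 else 0

  count : ∀ {m} → (Fin m → Bool) → ℕ
  count {zero}  P = 0
  count {suc m} P = bit (P zero) + count (P ∘ suc)

  every : ∀ {m} → (Fin m → Bool) → Bool
  every {zero}  P = true
  every {suc m} P = P zero ∧ every (P ∘ suc)

  every⇒ : ∀ {m} {P : Fin m → Bool} → every P ≡ true → ∀ i → P i ≡ true
  every⇒ p zero    = ∧-true⇒ˡ p
  every⇒ p (suc i) = every⇒ (∧-true⇒ʳ p) i

  ⇒every : ∀ {m} {P : Fin m → Bool} → (∀ i → P i ≡ true) → every P ≡ true
  ⇒every {zero}  f = refl
  ⇒every {suc m} f = ∧-true (f zero) (⇒every (f ∘ suc))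

  count-cong : ∀ {m} {P Q : Fin m → Bool} → (∀ i → P i ≡ Q i) → count P ≡ count Q
  count-cong {zero}  f = refl
  count-cong {suc m} f = cong₂ _+_ (cong bit (f zero)) (count-cong (f ∘ suc))

  count≤ : ∀ {m} (P : Fin m → Bool) → count P ≤ m
  count≤ {zero}  P = z≤n
  count≤ {suc m} P with P zero
  ... | true  = s≤s (count≤ (P ∘ suc))
  ... | false = ℕₚ.m≤n⇒m≤1+n (count≤ (P ∘ suc))

  count-false : ∀ {m} (P : Fin m → Bool) → (∀ i → P i ≡ false) → count P ≡ 0
  count-false {zero}  P f = refl
  count-false {suc m} P f rewrite f zero = count-false (P ∘ suc) (f ∘ suc)

  rank : ∀ {m} → (Fin m → Bool) → Fin m → ℕ
  rank P d = count (λ i → P i ∧ (toℕ i <ᵇ toℕ d))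

  rank-zero : ∀ {m} (P : Fin (suc m) → Bool) → rank P zero ≡ 0
  rank-zero P = count-false _ (λ i → Boolₚ.∧-zeroʳ (P i))

  rank-suc : ∀ {m} (P : Fin (suc m) → Bool) d → rank P (suc d) ≡ bit (P zero) + rank (P ∘ suc) d
  rank-suc P d = cong (λ b → bit b + rank (P ∘ suc) d) (Boolₚ.∧-identityʳ (P zero))

  rank-cong : ∀ {m} {P Q : Fin m → Bool} → (∀ i → P i ≡ Q i) → ∀ d → rank P d ≡ rank Q d
  rank-cong f d = count-cong (λ i → cong (_∧ (toℕ i <ᵇ toℕ d)) (f i))

  rank<count : ∀ {m} (P : Fin m → Bool) d → P d ≡ true → rank P d < count P
  rank<count P zero Pd rewrite rank-zero P | Pd = s≤s z≤n
  rank<count P (suc d) Pd rewrite rank-suc P d with P zero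
  ... | true  = s≤s (rank<count (P ∘ suc) d Pd)
  ... | false = rank<count (P ∘ suc) d Pd

  count>0 : ∀ {m} (P : Fin m → Bool) i → P i ≡ true → 0 < count P
  count>0 P i Pi = ℕₚ.≤-<-trans z≤n (rank<count P i Pi)

  select : ∀ {m} → (Fin m → Bool) → ℕ → Maybe (Fin m)
  select {zero}  P r = nothing
  select {suc m} P r = from (P zero) r
    where
    from : Bool → ℕ → Maybe (Fin (suc m))
    from true  zero    = just zero
    from true  (suc r) = Maybe.map suc (select (P ∘ suc) r)
    from false r       = Maybe.map suc (select (P ∘ suc) r)

  select-cong : ∀ {m} {P Q : Fin m → Bool} → (∀ i → P i ≡ Q i) → ∀ r → select P r ≡ select Q r
  select-cong {zero} f r = refl
  select-cong {suc m} {P} {Q} f r with P zero | Q zero | f zero | select-cong (f ∘ suc)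
  ... | true  | .true  | refl | ih with r
  ...   | zero  = refl
  ...   | suc r = cong (Maybe.map suc) (ih r)
  select-cong {suc m} f r | false | .false | refl | ih = cong (Maybe.map suc) (ih r)

  select-rank : ∀ {m} (P : Fin m → Bool) d → P d ≡ true → select P (rank P d) ≡ just d
  select-rank P zero Pd rewrite rank-zero P | Pd = refl
  select-rank P (suc d) Pd rewrite rank-suc P d with P zero
  ... | true  = cong (Maybe.map suc) (select-rank (P ∘ suc) d Pd)
  ... | false = cong (Maybe.map suc) (select-rank (P ∘ suc) d Pd)

  select-total : ∀ {m} (P : Fin m → Bool) r → r < count P →
                 ∃ λ d → select P r ≡ just d × P d ≡ true × rank P d ≡ r
  select-total {suc m} P r r< with P zero in Pz | rank-zero P
  select-total {suc m} P zero r< | true | rank0 = zero , refl , Pz , rank0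
  select-total {suc m} P (suc r) (s≤s r<) | true | _ with select-total (P ∘ suc) r r<
  ... | d , sel , Pd , rk = suc d , cong (Maybe.map suc) sel , Pd , cong suc rk
  select-total {suc m} P r r< | false | _ with select-total (P ∘ suc) r r<
  ... | d , sel , Pd , rk = suc d , cong (Maybe.map suc) sel , Pd , rk

module Walks {n : ℕ} (Γ : SimpleGraph n) where
  open SimpleGraph Γ

  Adj-sym : ∀ {x y} → Adj Γ x y → Adj Γ y x
  Adj-sym {x} {y} e = trans (symm y x) e

  Adj-irrefl : ∀ {x} → ¬ Adj Γ x x
  Adj-irrefl {x} e with () ← trans (sym (irrefl x)) e

  snoc : ∀ {x y z k} → Walk Γ x y k → Adj Γ y z → Walk Γ x z (suc k)
  snoc (here x)   e = step e (here _)
  snoc (step e′ w) e = step e′ (snoc w e)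

  reverse : ∀ {x y k} → Walk Γ x y k → Walk Γ y x k
  reverse (here x)   = here x
  reverse (step e w) = snoc (reverse w) (Adj-sym e)

  walk⁰ : ∀ {x y} → Walk Γ x y 0 → x ≡ y
  walk⁰ (here _) = refl

  walk? : ∀ k x y → Dec (Walk Γ x y k)
  walk? zero x y with x Finₚ.≟ y
  ... | yes refl = yes (here x)
  ... | no x≢y   = no λ { (here _) → x≢y refl }
  walk? (suc k) x y with Finₚ.any? (λ z → (adj x z Boolₚ.≟ true) ×-dec walk? k z y)
  ... | yes (z , e , w) = yes (step e w)
  ... | no none          = no λ { (step {y = z} e w) → none (z , e , w) }

  dist? : ∀ i x y → Dec (Dist Γ x y i)
  dist? i x y = map′ (λ (w , m) → w , λ j j<i → m j<i) (λ (w , m) → w , λ {j} → m j)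
    (walk? i x y ×-dec ℕₚ.allUpTo? (λ j → ¬? (walk? j x y)) i)

  Dist-unique : ∀ {x y i j} → Dist Γ x y i → Dist Γ x y j → i ≡ j
  Dist-unique {i = i} {j} (wᵢ , minᵢ) (wⱼ , minⱼ) with ℕₚ.<-cmp i j
  ... | tri< i<j _ _ = contradiction wᵢ (minⱼ i i<j)
  ... | tri≈ _ i≡j _ = i≡j
  ... | tri> _ _ j<i = contradiction wⱼ (minᵢ j j<i)

  shortest : ∀ {x y k} → Walk Γ x y k → ∃ (Dist Γ x y)
  shortest {x} {y} {k} = go k (<-wellFounded k)
    where
    go : ∀ k → Acc _<_ k → Walk Γ x y k → ∃ (Dist Γ x y)
    go k (acc rec) w with ℕₚ.anyUpTo? (λ j → walk? j x y) k
    ... | yes (j , j<k , w′) = go j (rec j<k) w′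
    ... | no none             = k , w , λ j j<k w′ → none (j , j<k , w′)

module Automorphisms {n : ℕ} (Γ : SimpleGraph n) (x₀ : Fin n) where
  open SimpleGraph Γ
  open RootedAut public

  Aut : Set
  Aut = RootedAut Γ x₀

  to : Aut → Fin n → Fin n
  to h = Inverse.to (perm h)

  from : Aut → Fin n → Fin n
  from h = Inverse.from (perm h)

  to-from : ∀ h y → to h (from h y) ≡ y
  to-from h = Inverse.strictlyInverseˡ (perm h)

  from-to : ∀ h y → from h (to h y) ≡ y
  from-to h = Inverse.strictlyInverseʳ (perm h)

  id-aut : Aut
  id-aut = record
    { perm = mk↔ₛ′ id id (λ _ → refl) (λ _ → refl) ; preserve = λ _ _ → refl ; fixRoot = refl }

  _∘ᵃ_ : Aut → Aut → Aut
  g ∘ᵃ h = record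
    { perm     = mk↔ₛ′ (to g ∘ to h) (from h ∘ from g)
                   (λ y → trans (cong (to g) (to-from h (from g y))) (to-from g y))
                   (λ z → trans (cong (from h) (from-to g (to h z))) (from-to h z))
    ; preserve = λ a b → trans (preserve g (to h a) (to h b)) (preserve h a b)
    ; fixRoot  = trans (cong (to g) (fixRoot h)) (fixRoot g) }

  _⁻¹ᵃ : Aut → Aut
  h ⁻¹ᵃ = record
    { perm     = mk↔ₛ′ (from h) (to h) (from-to h) (to-from h)
    ; preserve = λ a b → sym (trans (sym (cong₂ adj (to-from h a) (to-from h b)))
                                    (preserve h (from h a) (from h b)))
    ; fixRoot  = trans (cong (from h) (sym (fixRoot h))) (from-to h x₀) }

  aut-walk : ∀ h {a b k} → Walk Γ a b k → Walk Γ (to h a) (to h b) k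
  aut-walk h (here a) = here _
  aut-walk h (step {x = a} {y = b} e w) = step (trans (preserve h a b) e) (aut-walk h w)

  aut-dist : ∀ h {y i} → Dist Γ x₀ y i → Dist Γ x₀ (to h y) i
  aut-dist h {y} (w , minimal) =
    subst (λ r → Walk Γ r (to h y) _) (fixRoot h) (aut-walk h w) ,
    λ j j<i w′ → minimal j j<i
      (subst₂ (λ r s → Walk Γ r s j) (fixRoot (h ⁻¹ᵃ)) (from-to h y) (aut-walk (h ⁻¹ᵃ) w′))

  aut-dist⁻ : ∀ h {y i} → Dist Γ x₀ (to h y) i → Dist Γ x₀ y i
  aut-dist⁻ h {y} d = subst (λ r → Dist Γ x₀ r _) (from-to h y) (aut-dist (h ⁻¹ᵃ) d)

module Depth {n : ℕ} (Γ : SimpleGraph n) (x₀ : Fin n) (connected : Connected Γ) where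
  open Walks Γ
  open Automorphisms Γ x₀

  opaque
    depth : Fin n → ℕ
    depth y = proj₁ (shortest (proj₂ (connected x₀ y)))

    depth-dist : ∀ y → Dist Γ x₀ y (depth y)
    depth-dist y = proj₂ (shortest (proj₂ (connected x₀ y)))

  dist⇒depth : ∀ {y i} → Dist Γ x₀ y i → depth y ≡ i
  dist⇒depth = Dist-unique (depth-dist _)

  depth≤ : ∀ {y k} → Walk Γ x₀ y k → depth y ≤ k
  depth≤ {y} {k} w = ℕₚ.≮⇒≥ λ k<d → proj₂ (depth-dist y) k k<d w

  geodesic : ∀ y → Walk Γ y x₀ (depth y)
  geodesic y = reverse (proj₁ (depth-dist y))

  depth-adj : ∀ {a b} → Adj Γ b a → depth a ≤ suc (depth b)
  depth-adj {a} {b} e = depth≤ (snoc (proj₁ (depth-dist b)) e)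

  depth-root : depth x₀ ≡ 0
  depth-root = ℕₚ.n≤0⇒n≡0 (depth≤ (here x₀))

  depth⁰ : ∀ {y} → depth y ≡ 0 → y ≡ x₀
  depth⁰ {y} d≡0 = sym (walk⁰ (subst (Walk Γ x₀ y) d≡0 (proj₁ (depth-dist y))))

  depth-aut : ∀ h y → depth (to h y) ≡ depth y
  depth-aut h y = dist⇒depth (aut-dist h (depth-dist y))

  height : ℕ
  height = maximum depth

  depth≤height : ∀ y → depth y ≤ height
  depth≤height = maximum-upper depth

module Tree {n : ℕ} (Γ : SimpleGraph n) (x₀ : Fin n) (tree : IsTree Γ) where
  open Walks Γ
  open Depth Γ x₀ (proj₁ tree) public

  tailVertices : ∀ {x y k} → Walk Γ x y k → List (Fin n)
  tailVertices (here x)             = []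
  tailVertices (step {y = y} e w) = y ∷ tailVertices w

  walk-list : ∀ {x y k} (w : Walk Γ x y k) → IsWalkList Γ x y (x ∷ tailVertices w)
  walk-list (here x)   = one x
  walk-list (step e w) = cons e (walk-list w)

  length-tailVertices : ∀ {x y k} (w : Walk Γ x y k) → length (tailVertices w) ≡ k
  length-tailVertices (here x)   = refl
  length-tailVertices (step e w) = cong suc (length-tailVertices w)

  geodesic-step : ∀ {a b m} → Adj Γ a b → Walk Γ b x₀ m → depth a ≡ suc m → depth b ≡ m
  geodesic-step {a} {b} e w da = ℕₚ.≤-antisym (depth≤ (reverse w))
    (s≤s⁻¹ (subst (_≤ suc (depth b)) da (depth-adj (Adj-sym e))))

  geodesic-descends : ∀ {a m} (w : Walk Γ a x₀ m) → depth a ≡ m →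
                      All (λ v → depth v < m) (tailVertices w) × Unique (a ∷ tailVertices w)
  geodesic-descends (here _) _ = [] , ([] ∷ [])
  geodesic-descends {a} {suc m} (step {y = b} e w) da = below , (All.map a≢ below ∷ unique)
    where
    db = geodesic-step e w da
    rest = geodesic-descends w db
    unique = proj₂ rest
    below : All (λ v → depth v < suc m) (b ∷ tailVertices w)
    below = subst (_< suc m) (sym db) ℕₚ.≤-refl ∷ All.map ℕₚ.m<n⇒m<1+n (proj₁ rest)
    a≢ : ∀ {v} → depth v < suc m → a ≢ v
    a≢ dv refl = ℕₚ.<-irrefl da dv

  geodesic-path : ∀ {a m} (w : Walk Γ a x₀ m) → depth a ≡ m → IsPath Γ a x₀ (a ∷ tailVertices w)
  geodesic-path w da = walk-list w , proj₂ (geodesic-descends w da)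

  parent-unique : ∀ {p q y} → Adj Γ y p → Adj Γ y q →
                  depth y ≡ suc (depth p) → depth y ≡ suc (depth q) → p ≡ q
  parent-unique {p} {q} {y} yp yq dp dq =
    second (proj₂ tree y x₀ _ _ (geodesic-path (step yp (geodesic p)) dp)
                               (geodesic-path (step yq (geodesic q)) dq))
    where
    second : ∀ {a b : Fin n} {as bs} → _≡_ {A = List (Fin n)} (y ∷ a ∷ as) (y ∷ b ∷ bs) → a ≡ b
    second refl = refl

  -- Going down from z through a neighbour y of the same depth would give a second path to the root.
  adj⇒depth≢ : ∀ {y z} → Adj Γ y z → depth y ≢ depth z
  adj⇒depth≢ {y} {z} e dy≡dz = ℕₚ.1+n≢n (ℕₚ.suc-injective (begin
    suc (suc (depth z))                      ≡⟨ cong (λ t → suc (suc t)) (sym dy≡dz) ⟩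
    suc (suc (depth y))                      ≡⟨ cong (λ t → suc (suc t)) (sym (length-tailVertices (geodesic y))) ⟩
    length (z ∷ y ∷ tailVertices (geodesic y))   ≡⟨ cong length paths-equal ⟩
    length (z ∷ tailVertices (geodesic z))       ≡⟨ cong suc (length-tailVertices (geodesic z)) ⟩
    suc (depth z)                            ∎))
    where
    open ≡-Reasoning
    descent = geodesic-descends (geodesic y) refl
    z≢y : z ≢ y
    z≢y refl = Adj-irrefl e
    z≢below : ∀ {v} → depth v < depth y → z ≢ v
    z≢below dv refl = ℕₚ.<-irrefl (sym dy≡dz) dv
    detour : IsPath Γ z x₀ (z ∷ y ∷ tailVertices (geodesic y))
    detour = walk-list (step (Adj-sym e) (geodesic y)) ,
             ((z≢y ∷ All.map z≢below (proj₁ descent)) ∷ proj₂ descent)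
    paths-equal = proj₂ tree z x₀ _ _ detour (geodesic-path (geodesic z) refl)

  adj-depth : ∀ {y z} → Adj Γ y z → depth z ≡ suc (depth y) ⊎ depth y ≡ suc (depth z)
  adj-depth {y} {z} e with ℕₚ.<-cmp (depth y) (depth z)
  ... | tri< lt _ _ = inj₁ (ℕₚ.≤-antisym (depth-adj e) lt)
  ... | tri≈ _ eq _ = ⊥-elim (adj⇒depth≢ e eq)
  ... | tri> _ _ gt = inj₂ (ℕₚ.≤-antisym (depth-adj (Adj-sym e)) gt)

  next : ∀ {x y k} → Walk Γ x y k → Fin n
  next (here x)           = x
  next (step {y = v} _ _) = v

  -- the root is its own parent
  parent : Fin n → Fin n
  parent y = next (geodesic y)

  parent-spec : ∀ {y k} → depth y ≡ suc k → Adj Γ y (parent y) × depth (parent y) ≡ k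
  parent-spec {y} dy = first-step (geodesic y) refl dy
    where
    first-step : ∀ {y m k} (w : Walk Γ y x₀ m) → depth y ≡ m → m ≡ suc k →
                 Adj Γ y (next w) × depth (next w) ≡ k
    first-step (step e w) dy refl = e , geodesic-step e w dy

  parent-adj : ∀ {y k} → depth y ≡ suc k → Adj Γ (parent y) y
  parent-adj dy = Adj-sym (proj₁ (parent-spec dy))

  parent-of-child : ∀ {y c} → Adj Γ y c → depth c ≡ suc (depth y) → parent c ≡ y
  parent-of-child {y} {c} e dc with parent-spec dc
  ... | ep , dp = parent-unique ep (Adj-sym e) (trans dc (cong suc (sym dp))) dc

module Similarity {n : ℕ} (Γ : SimpleGraph n) (x₀ : Fin n) (tree : IsTree Γ) where
  open import Data.Nat using (_∸_)
  open SimpleGraph Γ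
  open Walks Γ
  open Tree Γ x₀ tree
  open Counting

  _==_ : ℕ → ℕ → Bool
  a == b = does (a ℕₚ.≟ b)

  isChild : Fin n → Fin n → Bool
  isChild y c = adj y c ∧ (depth c == suc (depth y))

  isChild⇒ : ∀ {y c} → isChild y c ≡ true → Adj Γ y c × depth c ≡ suc (depth y)
  isChild⇒ {y} {c} p = ∧-true⇒ˡ p , does⇒ (depth c ℕₚ.≟ suc (depth y)) (∧-true⇒ʳ p)

  ⇒isChild : ∀ {y c} → Adj Γ y c → depth c ≡ suc (depth y) → isChild y c ≡ true
  ⇒isChild {y} {c} e dc = ∧-true e (dec-true (depth c ℕₚ.≟ suc (depth y)) dc)

  isChild⇒parent : ∀ {y c} → isChild y c ≡ true → parent c ≡ y
  isChild⇒parent p = parent-of-child (proj₁ (isChild⇒ p)) (proj₂ (isChild⇒ p))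

  parent-isChild : ∀ {y k} → depth y ≡ suc k → isChild (parent y) y ≡ true
  parent-isChild {y} dy with parent-spec dy
  ... | e , dp = ⇒isChild (Adj-sym e) (trans dy (cong suc (sym dp)))

  -- For k at least the height of their subtrees, similar k a b says that a and b have isomorphic rooted subtrees.
  mutual
    similar : ℕ → Fin n → Fin n → Bool
    similar zero    a b = depth a == depth b
    similar (suc k) a b = (depth a == depth b) ∧ every (λ j → likeChildren k a j == likeChildren k b j)

    likeChildren : ℕ → Fin n → Fin n → ℕ
    likeChildren k a j = count (λ c → isChild a c ∧ similar k c j)

  similar⇒depth : ∀ k {a b} → similar k a b ≡ true → depth a ≡ depth b
  similar⇒depth zero    {a} {b} p = does⇒ (depth a ℕₚ.≟ depth b) p
  similar⇒depth (suc k) {a} {b} p = does⇒ (depth a ℕₚ.≟ depth b) (∧-true⇒ˡ p)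

  similar⇒likeChildren : ∀ k {a b} → similar (suc k) a b ≡ true → ∀ j → likeChildren k a j ≡ likeChildren k b j
  similar⇒likeChildren k {a} {b} p j =
    does⇒ (likeChildren k a j ℕₚ.≟ likeChildren k b j) (every⇒ (∧-true⇒ʳ p) j)

  ⇒similar : ∀ k {a b} → depth a ≡ depth b → (∀ j → likeChildren k a j ≡ likeChildren k b j) →
             similar (suc k) a b ≡ true
  ⇒similar k {a} {b} da lc =
    ∧-true (dec-true (depth a ℕₚ.≟ depth b) da)
           (⇒every λ j → dec-true (likeChildren k a j ℕₚ.≟ likeChildren k b j) (lc j))

  similar-refl : ∀ k a → similar k a a ≡ true
  similar-refl zero    a = dec-true (depth a ℕₚ.≟ depth a) refl
  similar-refl (suc k) a = ⇒similar k refl (λ _ → refl)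

  similar-sym : ∀ k {a b} → similar k a b ≡ true → similar k b a ≡ true
  similar-sym zero    {a} {b} p = dec-true (depth b ℕₚ.≟ depth a) (sym (similar⇒depth zero p))
  similar-sym (suc k) p = ⇒similar k (sym (similar⇒depth (suc k) p)) (sym ∘ similar⇒likeChildren k p)

  similar-trans : ∀ k {a b c} → similar k a b ≡ true → similar k b c ≡ true → similar k a c ≡ true
  similar-trans zero {a} {b} {c} p q =
    dec-true (depth a ℕₚ.≟ depth c) (trans (similar⇒depth zero p) (similar⇒depth zero q))
  similar-trans (suc k) p q =
    ⇒similar k (trans (similar⇒depth (suc k) p) (similar⇒depth (suc k) q))
               (λ j → trans (similar⇒likeChildren k p j) (similar⇒likeChildren k q j))

  similar-comm : ∀ k a b → similar k a b ≡ similar k b a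
  similar-comm k = BoolEquivalence.comm (similar k) (similar-sym k) (similar-trans k)

  similar-respʳ : ∀ k {c d} → similar k c d ≡ true → ∀ x → similar k x c ≡ similar k x d
  similar-respʳ k = BoolEquivalence.respʳ (similar k) (similar-sym k) (similar-trans k)

  likeChild : ℕ → Fin n → Fin n → Fin n → Bool
  likeChild k q c x = isChild q x ∧ similar k x c

  -- Sends a child c of p to the child of q whose rank among the children of q similar to c
  -- is the rank of c among the children of p similar to c.
  partner : ℕ → Fin n → Fin n → Fin n → Fin n
  partner k p q c = fromMaybe c (select (likeChild k q c) (rank (likeChild k p c) c))

  private
    partner-selected : ∀ k {p q c} → similar (suc k) p q ≡ true → isChild p c ≡ true →
      ∃ λ d → select (likeChild k q c) (rank (likeChild k p c) c) ≡ just d ×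
              likeChild k q c d ≡ true × rank (likeChild k q c) d ≡ rank (likeChild k p c) c
    partner-selected k {p} {q} {c} pq pc =
      select-total (likeChild k q c) _
        (subst (rank (likeChild k p c) c <_) (similar⇒likeChildren k pq c)
               (rank<count (likeChild k p c) c (∧-true pc (similar-refl k c))))

  partner-spec : ∀ k {p q c} → similar (suc k) p q ≡ true → isChild p c ≡ true →
                 isChild q (partner k p q c) ≡ true × similar k (partner k p q c) c ≡ true
  partner-spec k pq pc with partner-selected k pq pc
  ... | d , sel , qd , _ rewrite sel = ∧-true⇒ˡ qd , ∧-true⇒ʳ qd

  partner-involutive : ∀ k {p q c} → similar (suc k) p q ≡ true → isChild p c ≡ true →
                       partner k q p (partner k p q c) ≡ c
  partner-involutive k {p} {q} {c} pq pc with partner-selected k pq pc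
  ... | d , sel , qd , rank-d rewrite sel = begin
    fromMaybe d (select (likeChild k p d) (rank (likeChild k q d) d))
      ≡⟨ cong (fromMaybe d) (select-cong same-class _) ⟩
    fromMaybe d (select (likeChild k p c) (rank (likeChild k q d) d))
      ≡⟨ cong (λ r → fromMaybe d (select (likeChild k p c) r)) (trans (rank-cong same-class d) rank-d) ⟩
    fromMaybe d (select (likeChild k p c) (rank (likeChild k p c) c))
      ≡⟨ cong (fromMaybe d) (select-rank (likeChild k p c) c (∧-true pc (similar-refl k c))) ⟩
    c ∎
    where
    open ≡-Reasoning
    same-class : ∀ {r} x → likeChild k r d x ≡ likeChild k r c x
    same-class {r} x = cong (isChild r x ∧_) (similar-respʳ k (∧-true⇒ʳ qd) x)

  -- at least the height of the subtree at z
  fuel : Fin n → ℕ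
  fuel z = suc height ∸ depth z

  fuel-child : ∀ {p c} → isChild p c ≡ true → fuel p ≡ suc (fuel c)
  fuel-child {p} {c} pc with proj₂ (isChild⇒ pc)
  ... | dc rewrite dc = ℕₚ.+-∸-assoc 1 (ℕₚ.<⇒≤ (subst (_≤ height) dc (depth≤height c)))

  _≅_ : Fin n → Fin n → Set
  a ≅ b = similar (fuel a) a b ≡ true

  ≅-refl : ∀ a → a ≅ a
  ≅-refl a = similar-refl (fuel a) a

  ≅⇒depth : ∀ {a b} → a ≅ b → depth a ≡ depth b
  ≅⇒depth {a} = similar⇒depth (fuel a)

  ≅-sym : ∀ {a b} → a ≅ b → b ≅ a
  ≅-sym {a} {b} p = subst (λ t → similar (suc height ∸ t) b a ≡ true) (≅⇒depth p) (similar-sym (fuel a) p)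

  ≅-trans : ∀ {a b c} → a ≅ b → b ≅ c → a ≅ c
  ≅-trans {a} {b} {c} p q =
    similar-trans (fuel a) p (subst (λ t → similar (suc height ∸ t) b c ≡ true) (sym (≅⇒depth p)) q)

module Subtrees {n : ℕ} (Γ : SimpleGraph n) (x₀ : Fin n) (tree : IsTree Γ) where
  open import Data.Nat using (_+_; _∸_)
  open SimpleGraph Γ
  open Walks Γ
  open Tree Γ x₀ tree
  open Similarity Γ x₀ tree

  ancestor : ℕ → Fin n → Fin n
  ancestor zero    z = z
  ancestor (suc d) z = ancestor d (parent z)

  Below : Fin n → Fin n → ℕ → Set
  Below x z d = depth z ≡ d + depth x × ancestor d z ≡ x

  below-offset : ∀ {x z d} → Below x z d → depth z ∸ depth x ≡ d
  below-offset {x} {z} {d} (dz , _) = trans (cong (_∸ depth x) dz) (ℕₚ.m+n∸n≡m d (depth x))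

  below-unique : ∀ {x z d d′} → Below x z d → Below x z d′ → d ≡ d′
  below-unique b b′ = trans (sym (below-offset b)) (below-offset b′)

  below? : ∀ x z → Dec (∃ (Below x z))
  below? x z with depth x ℕₚ.≤? depth z | ancestor (depth z ∸ depth x) z Finₚ.≟ x
  ... | yes dx≤dz | yes top = yes (depth z ∸ depth x , sym (ℕₚ.m∸n+n≡m dx≤dz) , top)
  ... | no dx≰dz  | _       = no λ (d , dz , _) → dx≰dz (subst (depth x ≤_) (sym dz) (ℕₚ.m≤n+m _ d))
  ... | yes _     | no ¬top = no λ (d , b) → ¬top (trans (cong (λ t → ancestor t z) (below-offset b)) (proj₂ b))

  below-refl : ∀ x → Below x x 0
  below-refl x = refl , refl

  below⁰ : ∀ {x z} → Below x z 0 → z ≡ x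
  below⁰ = proj₂

  below-child : ∀ {x a b d} → Below x a d → isChild a b ≡ true → Below x b (suc d)
  below-child {d = d} (da , top) ab =
    trans (proj₂ (isChild⇒ ab)) (cong suc da) , trans (cong (ancestor d) (isChild⇒parent ab)) top

  below-parent : ∀ {x b d} → Below x b (suc d) → Below x (parent b) d × isChild (parent b) b ≡ true
  below-parent (db , top) = (proj₂ (parent-spec db) , top) , parent-isChild db

  below-same-depth : ∀ {x y z d d′} → depth x ≡ depth y → Below x z d → Below y z d′ → x ≡ y
  below-same-depth {z = z} dxy bx by
    with trans (sym (below-offset bx)) (trans (cong (depth z ∸_) dxy) (below-offset by))
  ... | refl = trans (sym (proj₂ bx)) (proj₂ by)

  enters-at-top : ∀ {x a b d} → ¬ ∃ (Below x a) → isChild a b ≡ true → Below x b d → b ≡ x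
  enters-at-top {d = zero}  a∉ ab b∈ = below⁰ b∈
  enters-at-top {d = suc d} a∉ ab b∈ =
    ⊥-elim (a∉ (d , subst (λ t → Below _ t d) (isChild⇒parent ab) (proj₁ (below-parent b∈))))

  -- the image in the subtree of y of a vertex z lying d levels below some x ≅ y
  transport : Fin n → ℕ → Fin n → Fin n
  transport y zero    z = y
  transport y (suc d) z = partner (fuel z) (parent z) (transport y d (parent z)) z

  module Transport (x y : Fin n) (xy : x ≅ y) where
    mutual
      transport-spec : ∀ d z → Below x z d →
                       Below y (transport y d z) d × z ≅ transport y d z ×
                       transport x d (transport y d z) ≡ z
      transport-spec zero z (_ , refl) = (refl , refl) , xy , refl
      transport-spec (suc d) z z∈ with parent-similar d z z∈
      ... | pz , pq = below-child q∈ qw , similar-sym K wz , back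
        where
        K = fuel z
        p = parent z
        q = transport y d p
        w = transport y (suc d) z
        q∈ = proj₁ (transport-spec d p (proj₁ (below-parent z∈)))
        qw = proj₁ (partner-spec K pq pz)
        wz = proj₂ (partner-spec K pq pz)
        back : transport x (suc d) w ≡ z
        back = begin
          partner (fuel w) (parent w) (transport x d (parent w)) w
            ≡⟨ cong₂ (λ k t → partner k t (transport x d t) w)
                     (cong (suc height ∸_) (similar⇒depth K wz)) (isChild⇒parent qw) ⟩
          partner K q (transport x d q) w
            ≡⟨ cong (λ t → partner K q t w) (proj₂ (proj₂ (transport-spec d p (proj₁ (below-parent z∈))))) ⟩
          partner K q p w
            ≡⟨ partner-involutive K pq pz ⟩
          z ∎
          where open ≡-Reasoning

      parent-similar : ∀ d z → Below x z (suc d) →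
                       isChild (parent z) z ≡ true × similar (suc (fuel z)) (parent z) (transport y d (parent z)) ≡ true
      parent-similar d z z∈ with below-parent z∈
      ... | p∈ , pz = pz , subst (λ k → similar k (parent z) (transport y d (parent z)) ≡ true) (fuel-child pz)
                                 (proj₁ (proj₂ (transport-spec d _ p∈)))

    transport-adj : ∀ {a b d} → Below x a d → isChild a b ≡ true → Adj Γ (transport y d a) (transport y (suc d) b)
    transport-adj {a} {b} {d} a∈ ab with parent-similar d b (below-child a∈ ab)
    ... | pb , pq = subst (λ t → Adj Γ (transport y d t) (transport y (suc d) b)) (isChild⇒parent ab)
                          (proj₁ (isChild⇒ (proj₁ (partner-spec (fuel b) pq pb))))

  module Swap {x y : Fin n} (x≢y : x ≢ y) (siblings : parent x ≡ parent y) {k : ℕ} (dx : depth x ≡ suc k)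
              (xy : x ≅ y) where

    dxy : depth x ≡ depth y
    dxy = ≅⇒depth xy

    module X = Transport x y xy
    module Y = Transport y x (≅-sym xy)

    swap : Fin n → Fin n
    swap z with below? x z | below? y z
    ... | yes (d , _) | _           = transport y d z
    ... | no _        | yes (d , _) = transport x d z
    ... | no _        | no _        = z

    swap-x : ∀ {z d} → Below x z d → swap z ≡ transport y d z
    swap-x {z} z∈ with below? x z | below? y z
    ... | yes (_ , z∈′) | _ = cong (λ t → transport y t z) (below-unique z∈′ z∈)
    ... | no z∉         | _ = ⊥-elim (z∉ (_ , z∈))

    swap-y : ∀ {z d} → Below y z d → swap z ≡ transport x d z
    swap-y {z} z∈ with below? x z | below? y z
    ... | yes (_ , z∈x) | _             = ⊥-elim (x≢y (below-same-depth dxy z∈x z∈))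
    ... | no _          | yes (_ , z∈′) = cong (λ t → transport x t z) (below-unique z∈′ z∈)
    ... | no _          | no z∉         = ⊥-elim (z∉ (_ , z∈))

    swap-outside : ∀ {z} → ¬ ∃ (Below x z) → ¬ ∃ (Below y z) → swap z ≡ z
    swap-outside {z} z∉x z∉y with below? x z | below? y z
    ... | yes z∈ | _      = ⊥-elim (z∉x z∈)
    ... | no _   | yes z∈ = ⊥-elim (z∉y z∈)
    ... | no _   | no _   = refl

    data Region (z : Fin n) : Set where
      in-x    : ∀ {d} → Below x z d → Region z
      in-y    : ∀ {d} → Below y z d → Region z
      outside : ¬ ∃ (Below x z) → ¬ ∃ (Below y z) → Region z

    region : ∀ z → Region z
    region z with below? x z | below? y z
    ... | yes (_ , z∈) | _            = in-x z∈
    ... | no _         | yes (_ , z∈) = in-y z∈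
    ... | no z∉x       | no z∉y       = outside z∉x z∉y

    swap-involutive : ∀ z → swap (swap z) ≡ z
    swap-involutive z with region z
    ... | in-x {d} z∈ = let w∈ , _ , back = X.transport-spec d z z∈ in
                        trans (cong swap (swap-x z∈)) (trans (swap-y w∈) back)
    ... | in-y {d} z∈ = let w∈ , _ , back = Y.transport-spec d z z∈ in
                        trans (cong swap (swap-y z∈)) (trans (swap-x w∈) back)
    ... | outside z∉x z∉y = trans (cong swap (swap-outside z∉x z∉y)) (swap-outside z∉x z∉y)

    swap-similar : ∀ z → z ≅ swap z
    swap-similar z with region z
    ... | in-x {d} z∈ = subst (z ≅_) (sym (swap-x z∈)) (proj₁ (proj₂ (X.transport-spec d z z∈)))
    ... | in-y {d} z∈ = subst (z ≅_) (sym (swap-y z∈)) (proj₁ (proj₂ (Y.transport-spec d z z∈)))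
    ... | outside z∉x z∉y = subst (z ≅_) (sym (swap-outside z∉x z∉y)) (≅-refl z)

    swap-maps : swap x ≡ y
    swap-maps = swap-x (below-refl x)

    swap-root : swap x₀ ≡ x₀
    swap-root = swap-outside (root∉ dx) (root∉ (trans (sym dxy) dx))
      where
      root∉ : ∀ {w} → depth w ≡ suc k → ¬ ∃ (Below w x₀)
      root∉ dw (d , dr , _) = ℕₚ.1+n≢0 (trans (sym dw) (ℕₚ.m+n≡0⇒n≡0 d (trans (sym dr) depth-root)))

    swap-child : ∀ {a b} → isChild a b ≡ true → Adj Γ (swap a) (swap b)
    swap-child {a} {b} ab with region a
    ... | in-x a∈ = subst₂ (Adj Γ) (sym (swap-x a∈)) (sym (swap-x (below-child a∈ ab))) (X.transport-adj a∈ ab)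
    ... | in-y a∈ = subst₂ (Adj Γ) (sym (swap-y a∈)) (sym (swap-y (below-child a∈ ab))) (Y.transport-adj a∈ ab)
    ... | outside a∉x a∉y with region b
    ...   | in-x b∈ = subst₂ (Adj Γ) (sym (swap-outside a∉x a∉y)) (sym (trans (cong swap b≡x) swap-maps)) a-y
      where
      b≡x = enters-at-top a∉x ab b∈
      a-y : Adj Γ a y
      a-y = subst (λ t → Adj Γ t y) (trans (sym siblings) (trans (cong parent (sym b≡x)) (isChild⇒parent ab)))
                  (parent-adj (trans (sym dxy) dx))
    ...   | in-y b∈ = subst₂ (Adj Γ) (sym (swap-outside a∉x a∉y)) (sym (trans (cong swap b≡y) (swap-y (below-refl y)))) a-x
      where
      b≡y = enters-at-top a∉y ab b∈
      a-x : Adj Γ a x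
      a-x = subst (λ t → Adj Γ t x) (trans siblings (trans (cong parent (sym b≡y)) (isChild⇒parent ab)))
                  (parent-adj dx)
    ...   | outside b∉x b∉y =
      subst₂ (Adj Γ) (sym (swap-outside a∉x a∉y)) (sym (swap-outside b∉x b∉y)) (proj₁ (isChild⇒ ab))

    swap-adj : ∀ {a b} → Adj Γ a b → Adj Γ (swap a) (swap b)
    swap-adj {a} {b} ab with adj-depth ab
    ... | inj₁ db = swap-child (⇒isChild ab db)
    ... | inj₂ da = Adj-sym (swap-child (⇒isChild (Adj-sym ab) da))

    swap-preserve : ∀ a b → adj (swap a) (swap b) ≡ adj a b
    swap-preserve a b with adj a b in ab
    ... | true = swap-adj ab
    ... | false with adj (swap a) (swap b) in σab
    ...   | false = refl
    ...   | true  = trans (sym (subst₂ (λ s t → adj s t ≡ true) (swap-involutive a) (swap-involutive b) (swap-adj σab))) ab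

    swap-aut : RootedAut Γ x₀
    swap-aut = record
      { perm = mk↔ₛ′ swap swap swap-involutive swap-involutive ; preserve = swap-preserve ; fixRoot = swap-root }

module Orbits {n : ℕ} (Γ : SimpleGraph n) (x₀ : Fin n) (tree : IsTree Γ) where
  open Automorphisms Γ x₀
  open Tree Γ x₀ tree
  open Similarity Γ x₀ tree
  open Subtrees Γ x₀ tree

  lineage : ℕ → Fin n → Fin n → Bool
  lineage zero    a b = similar (fuel a) a b
  lineage (suc k) a b = similar (fuel a) a b ∧ lineage k (parent a) (parent b)

  lineage⇒≅ : ∀ k {a b} → lineage k a b ≡ true → a ≅ b
  lineage⇒≅ zero    p = p
  lineage⇒≅ (suc k) p = ∧-true⇒ˡ p

  lineage-refl : ∀ k a → depth a ≡ k → lineage k a a ≡ true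
  lineage-refl zero    a da = ≅-refl a
  lineage-refl (suc k) a da = ∧-true (≅-refl a) (lineage-refl k (parent a) (proj₂ (parent-spec da)))

  lineage-sym : ∀ k {a b} → lineage k a b ≡ true → lineage k b a ≡ true
  lineage-sym zero    p = ≅-sym p
  lineage-sym (suc k) p = ∧-true (≅-sym (∧-true⇒ˡ p)) (lineage-sym k (∧-true⇒ʳ p))

  lineage-trans : ∀ k {a b c} → lineage k a b ≡ true → lineage k b c ≡ true → lineage k a c ≡ true
  lineage-trans zero    p q = ≅-trans p q
  lineage-trans (suc k) p q =
    ∧-true (≅-trans (∧-true⇒ˡ p) (∧-true⇒ˡ q)) (lineage-trans k (∧-true⇒ʳ p) (∧-true⇒ʳ q))

  sameClass : Fin n → Fin n → Bool
  sameClass x y = lineage (depth x) x y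

  sameClass-refl : ∀ x → sameClass x x ≡ true
  sameClass-refl x = lineage-refl (depth x) x refl

  sameClass⇒depth : ∀ {x y} → sameClass x y ≡ true → depth x ≡ depth y
  sameClass⇒depth {x} p = ≅⇒depth (lineage⇒≅ (depth x) p)

  sameClass-sym : ∀ {x y} → sameClass x y ≡ true → sameClass y x ≡ true
  sameClass-sym {x} {y} p = subst (λ t → lineage t y x ≡ true) (sameClass⇒depth p) (lineage-sym (depth x) p)

  sameClass-trans : ∀ {x y w} → sameClass x y ≡ true → sameClass y w ≡ true → sameClass x w ≡ true
  sameClass-trans {x} {y} {w} p q =
    lineage-trans (depth x) p (subst (λ t → lineage t y w ≡ true) (sym (sameClass⇒depth p)) q)

  sameClass-comm : ∀ x y → sameClass x y ≡ sameClass y x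
  sameClass-comm = BoolEquivalence.comm sameClass sameClass-sym sameClass-trans

  sameClass-resp : ∀ {x y} → sameClass x y ≡ true → ∀ w → sameClass x w ≡ sameClass y w
  sameClass-resp = BoolEquivalence.respˡ sameClass sameClass-sym sameClass-trans

  MovesToSimilar : Aut → Set
  MovesToSimilar h = ∀ z → z ≅ to h z

  ∘-moves : ∀ g h → MovesToSimilar g → MovesToSimilar h → MovesToSimilar (g ∘ᵃ h)
  ∘-moves g h g-sim h-sim z = ≅-trans (h-sim z) (g-sim (to h z))

  -- Once the parent of a is sent to the parent of b, swapping two sibling subtrees sends a to b.
  align : ∀ {a b k} h → MovesToSimilar h → depth a ≡ suc k → to h (parent a) ≡ parent b → a ≅ b →
          Σ Aut λ g → to g a ≡ b × MovesToSimilar g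
  align {a} {b} {k} h h-sim da hp ab with to h a Finₚ.≟ b
  ... | yes ha≡b = h , ha≡b , h-sim
  ... | no ha≢b  = swap-aut ∘ᵃ h , swap-maps , ∘-moves swap-aut h swap-similar h-sim
    where
    a′ = to h a
    da′ : depth a′ ≡ suc k
    da′ = trans (depth-aut h a) da
    dp : depth (parent b) ≡ k
    dp = trans (cong depth (sym hp)) (trans (depth-aut h (parent a)) (proj₂ (parent-spec da)))
    siblings : parent a′ ≡ parent b
    siblings = parent-of-child (subst (λ t → Adj Γ t a′) hp (trans (preserve h (parent a) a) (parent-adj da)))
                               (trans da′ (cong suc (sym dp)))
    open Swap ha≢b siblings da′ (≅-trans (≅-sym (h-sim a)) ab)

  lineage⇒orbit : ∀ k {a b} → depth a ≡ k → lineage k a b ≡ true → Σ Aut λ h → to h a ≡ b × MovesToSimilar h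
  lineage⇒orbit zero {a} {b} da p =
    id-aut , trans (depth⁰ da) (sym (depth⁰ (trans (sym (≅⇒depth p)) da))) , ≅-refl
  lineage⇒orbit (suc k) da p with lineage⇒orbit k (proj₂ (parent-spec da)) (∧-true⇒ʳ p)
  ... | h , hp , h-sim = align h h-sim da hp (∧-true⇒ˡ p)

  sameClass⇒orbit : ∀ {x y} → sameClass x y ≡ true → SameOrbit Γ x₀ x y
  sameClass⇒orbit {x} p with lineage⇒orbit (depth x) refl p
  ... | h , hx , _ = h , hx

module FieldFacts {c ℓ} (K : CharZeroField c ℓ) where
  open CharZeroField K hiding (zero) renaming (refl to ≈-refl; sym to ≈-sym; trans to ≈-trans; setoid to ≈-setoid)
  open Standard K
  open import Algebra.Properties.Semiring.Sum semiring public
  import Algebra.Properties.CommutativeMonoid.Sum *-commutativeMonoid as Product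
  import Algebra.Properties.Group +-group as +-Group
  open import Relation.Binary.Reasoning.Setoid ≈-setoid

  ℕ⟶K : ℕ → Carrier
  ℕ⟶K = ofℕ commRing

  ℕ⟶K-injective : ∀ a b → ℕ⟶K a ≈ ℕ⟶K b → a ≡ b
  ℕ⟶K-injective zero    zero    _  = refl
  ℕ⟶K-injective zero    (suc b) eq = ⊥-elim (charZero b (≈-sym eq))
  ℕ⟶K-injective (suc a) zero    eq = ⊥-elim (charZero a eq)
  ℕ⟶K-injective (suc a) (suc b) eq = cong suc (ℕ⟶K-injective a b (+-Group.∙-cancelˡ 1# (ℕ⟶K a) (ℕ⟶K b) eq))

  ℕ⟶K-difference≉0 : ∀ {a b} → a ≢ b → ¬ (ℕ⟶K a - ℕ⟶K b ≈ 0#)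
  ℕ⟶K-difference≉0 {a} {b} a≢b eq = a≢b (ℕ⟶K-injective a b (+-Group.x∙y⁻¹≈ε⇒x≈y (ℕ⟶K a) (ℕ⟶K b) eq))

  [true] : ∀ {b} → b ≡ true → [ b ] ≈ 1#
  [true] refl = ≈-refl

  [false] : ∀ {b} → b ≢ true → [ b ] ≈ 0#
  [false] {true}  b≢ = ⊥-elim (b≢ refl)
  [false] {false} _  = ≈-refl

  [∧] : ∀ a b → [ a ∧ b ] ≈ [ a ] * [ b ]
  [∧] true  b = ≈-sym (*-identityˡ _)
  [∧] false b = ≈-sym (zeroˡ _)

  ∑≡sum : ∀ {m} (f : Fin m → Carrier) → ∑ f ≡ sum f
  ∑≡sum {zero}  f = refl
  ∑≡sum {suc m} f = cong (f zero +_) (∑≡sum (f ∘ suc))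

  sum-single : ∀ {m} (f : Fin m → Carrier) i → (∀ j → j ≢ i → f j ≈ 0#) → sum f ≈ f i
  sum-single {suc m} f i f≈0 = begin
    sum f                                  ≈⟨ sum-remove f ⟩
    f i + sum (f ∘ punchIn i)              ≈⟨ +-congˡ (sum-cong-≋ λ j → f≈0 _ (Finₚ.punchInᵢ≢i i j)) ⟩
    f i + sum {m} (λ _ → 0#)               ≈⟨ +-congˡ (sum-replicate-zero m) ⟩
    f i + 0#                               ≈⟨ +-identityʳ (f i) ⟩
    f i                                    ∎

  sum-count : ∀ {m} (P : Fin m → Bool) → ℕ⟶K (Counting.count P) ≈ sum (λ i → [ P i ])
  sum-count {zero}  P = ≈-refl
  sum-count {suc m} P with P zero
  ... | true  = +-congˡ (sum-count (P ∘ suc))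
  ... | false = ≈-trans (≈-sym (+-identityˡ _)) (+-congˡ (sum-count (P ∘ suc)))

  ∏ : ∀ {m} → (Fin m → Carrier) → Carrier
  ∏ = Product.sum

  ∏-one : ∀ {m} (f : Fin m → Carrier) → (∀ i → f i ≈ 1#) → ∏ f ≈ 1#
  ∏-one {m} f f≈1 = ≈-trans (Product.sum-cong-≋ f≈1) (Product.sum-replicate-zero m)

  ∏-zero : ∀ {m} (f : Fin m → Carrier) i → f i ≈ 0# → ∏ f ≈ 0#
  ∏-zero {suc m} f i fi≈0 = ≈-trans (Product.sum-remove f) (≈-trans (*-congʳ fi≈0) (zeroˡ _))

  [every] : ∀ {m} (P : Fin m → Bool) → [ Counting.every P ] ≈ ∏ (λ j → [ P j ])
  [every] {zero}  P = ≈-refl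
  [every] {suc m} P = ≈-trans ([∧] (P zero) _) (*-congˡ ([every] (P ∘ suc)))

  [b]*-guarded : ∀ {b x y} → (b ≡ true → x ≈ y) → [ b ] * x ≈ [ b ] * y
  [b]*-guarded {true}  x≈y = *-congˡ (x≈y refl)
  [b]*-guarded {false} _   = ≈-trans (zeroˡ _) (≈-sym (zeroˡ _))

  [b]*≈ : ∀ {b} x → b ≡ true → [ b ] * x ≈ x
  [b]*≈ x b≡true = ≈-trans (*-congʳ ([true] b≡true)) (*-identityˡ x)

  [b]*≈0 : ∀ {b} x → b ≢ true → [ b ] * x ≈ 0#
  [b]*≈0 x b≢true = ≈-trans (*-congʳ ([false] b≢true)) (zeroˡ x)

  -- junk value 0 at 0
  ℕ⟶K⁻¹ : ℕ → Carrier
  ℕ⟶K⁻¹ zero    = 0#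
  ℕ⟶K⁻¹ (suc m) = proj₁ (inverse (ℕ⟶K (suc m)) (charZero m))

  ℕ⟶K-inverse : ∀ m → 0 < m → ℕ⟶K m * ℕ⟶K⁻¹ m ≈ 1#
  ℕ⟶K-inverse (suc m) _ = proj₂ (inverse (ℕ⟶K (suc m)) (charZero m))

  sum-closed : ∀ {p} {n} (P : Vec n → Set p) → P (λ _ → 0#) → (∀ {u v} → P u → P v → P (λ y → u y + v y)) →
               ∀ {m} (F : Fin m → Vec n) → (∀ i → P (F i)) → P (λ y → sum (λ i → F i y))
  sum-closed P P0 P+ {zero}  F PF = P0
  sum-closed P P0 P+ {suc m} F PF = P+ (PF zero) (sum-closed P P0 P+ (F ∘ suc) (PF ∘ suc))

module Invariance {c ℓ} (K : CharZeroField c ℓ) {n : ℕ} (Γ : SimpleGraph n) (x₀ : Fin n) where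
  open CharZeroField K hiding (zero) renaming (refl to ≈-refl; sym to ≈-sym; trans to ≈-trans; setoid to ≈-setoid)
  open Standard K
  open FieldFacts K
  open SimpleGraph Γ
  open Walks Γ
  open Automorphisms Γ x₀
  open import Relation.Binary.Reasoning.Setoid ≈-setoid

  Invariant : Vec n → Set ℓ
  Invariant v = ∀ h y → v (to h y) ≈ v y

  basis-invariant : ∀ {v} → IsBasisVec Γ x₀ x₀ v → Invariant v
  basis-invariant v-x₀ h y with y Finₚ.≟ x₀
  ... | yes refl = ≈-trans (proj₁ (v-x₀ (to h x₀)) (fixRoot h)) (≈-sym (proj₁ (v-x₀ x₀) refl))
  ... | no y≢x₀  = ≈-trans (proj₂ (v-x₀ (to h y)) hy≢x₀) (≈-sym (proj₂ (v-x₀ y) y≢x₀))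
    where
    hy≢x₀ : to h y ≢ x₀
    hy≢x₀ hy≡x₀ = y≢x₀ (trans (sym (from-to h y)) (trans (cong (from h) (trans hy≡x₀ (sym (fixRoot h)))) (from-to h x₀)))

  A-invariant : ∀ {u} → Invariant u → Invariant (Aₘ Γ x₀ u)
  A-invariant {u} u-inv h y = begin
    ∑ (λ z → [ adj (to h y) z ] * u z)                   ≡⟨ ∑≡sum {n} _ ⟩
    sum (λ z → [ adj (to h y) z ] * u z)                 ≈⟨ sum-permute _ (perm h) ⟩
    sum (λ z → [ adj (to h y) (to h z) ] * u (to h z))
      ≈⟨ sum-cong-≋ (λ z → *-cong (reflexive (cong [_] (preserve h y z))) (u-inv h z)) ⟩
    sum (λ z → [ adj y z ] * u z)                        ≡⟨ ∑≡sum {n} _ ⟨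
    ∑ (λ z → [ adj y z ] * u z)                          ∎

  E*-invariant : ∀ i {u w} → Invariant u → IsEStar Γ x₀ i u w → Invariant w
  E*-invariant i u-inv w-u h y with dist? i x₀ y
  ... | yes d = ≈-trans (proj₁ (w-u (to h y)) (aut-dist h d)) (≈-trans (u-inv h y) (≈-sym (proj₁ (w-u y) d)))
  ... | no ¬d = ≈-trans (proj₂ (w-u (to h y)) (¬d ∘ aut-dist⁻ h)) (≈-sym (proj₂ (w-u y) ¬d))

  W₀-invariant : ∀ {v} → InW₀ Γ x₀ v → Invariant v
  W₀-invariant (base v v-x₀)    = basis-invariant v-x₀
  W₀-invariant zero∈            h y = ≈-refl
  W₀-invariant (add u∈ v∈)      h y = +-cong (W₀-invariant u∈ h y) (W₀-invariant v∈ h y)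
  W₀-invariant (scale a u∈)     h y = *-congˡ (W₀-invariant u∈ h y)
  W₀-invariant (applyA u∈)      = A-invariant (W₀-invariant u∈)
  W₀-invariant (applyE i u∈ w-u) = E*-invariant i (W₀-invariant u∈) w-u
  W₀-invariant (resp u∈ u≈v)    h y = ≈-trans (≈-sym (u≈v (to h y))) (≈-trans (W₀-invariant u∈ h y) (u≈v y))

module Multipliers {c ℓ} (K : CharZeroField c ℓ) {n : ℕ} (Γ : SimpleGraph n) (x₀ : Fin n) (tree : IsTree Γ) where
  open CharZeroField K hiding (zero) renaming (refl to ≈-refl; sym to ≈-sym; trans to ≈-trans; setoid to ≈-setoid)
  open Standard K
  open FieldFacts K
  open SimpleGraph Γ
  open Walks Γ
  open Tree Γ x₀ tree
  open Similarity Γ x₀ tree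
  open Counting
  open import Algebra.Properties.CommutativeSemigroup *-commutativeSemigroup using (x∙yz≈y∙xz)
  open import Relation.Binary.Reasoning.Setoid ≈-setoid

  A : Vec n → Vec n
  A = Aₘ Γ x₀

  A-single : ∀ u {y q} → Adj Γ y q → (∀ z → Adj Γ y z → z ≢ q → u z ≈ 0#) → A u y ≈ u q
  A-single u {y} {q} yq others = begin
    ∑ (λ z → [ adj y z ] * u z)    ≡⟨ ∑≡sum {n} _ ⟩
    sum (λ z → [ adj y z ] * u z)  ≈⟨ sum-single _ q vanish ⟩
    [ adj y q ] * u q              ≈⟨ [b]*≈ (u q) yq ⟩
    u q                            ∎
    where
    vanish : ∀ z → z ≢ q → [ adj y z ] * u z ≈ 0#
    vanish z z≢q with adj y z in yz
    ... | true  = ≈-trans (*-identityˡ _) (others z yz z≢q)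
    ... | false = zeroˡ _

  E* : ℕ → Vec n → Vec n
  E* i u y = [ depth y == i ] * u y

  E*∈W₀ : ∀ i {u} → InW₀ Γ x₀ u → InW₀ Γ x₀ (E* i u)
  E*∈W₀ i {u} u∈ = applyE i u∈ λ y →
    (λ d → [b]*≈ (u y) (dec-true (depth y ℕₚ.≟ i) (dist⇒depth d))) ,
    (λ ¬d → [b]*≈0 (u y) λ t → ¬d (subst (Dist Γ x₀ y) (does⇒ (depth y ℕₚ.≟ i) t) (depth-dist y)))

  E*-levels : ∀ (F : ℕ → Vec n) y → sum {suc height} (λ i → E* (toℕ i) (F (toℕ i)) y) ≈ F (depth y) y
  E*-levels F y = ≈-trans (sum-single _ level others) at-level
    where
    level = fromℕ< (s≤s (depth≤height y))
    others : ∀ i → i ≢ level → E* (toℕ i) (F (toℕ i)) y ≈ 0#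
    others i i≢ = [b]*≈0 _ λ t → i≢ (Finₚ.toℕ-injective
      (trans (sym (does⇒ (depth y ℕₚ.≟ toℕ i) t)) (sym (Finₚ.toℕ-fromℕ< (s≤s (depth≤height y))))))
    at-level : E* (toℕ level) (F (toℕ level)) y ≈ F (depth y) y
    at-level rewrite Finₚ.toℕ-fromℕ< (s≤s (depth≤height y)) = [b]*≈ _ (dec-true (depth y ℕₚ.≟ depth y) refl)

  Multiplier : Vec n → Set (c ⊔ˡ ℓ)
  Multiplier f = ∀ {u} → InW₀ Γ x₀ u → InW₀ Γ x₀ (λ y → f y * u y)

  multiplier-resp : ∀ {f g} → Multiplier f → (∀ y → f y ≈ g y) → Multiplier g
  multiplier-resp f-mult f≈g u∈ = resp (f-mult u∈) (λ y → *-congʳ (f≈g y))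

  multiplier-const : ∀ a → Multiplier (λ _ → a)
  multiplier-const a = scale a

  multiplier-+ : ∀ {f g} → Multiplier f → Multiplier g → Multiplier (λ y → f y + g y)
  multiplier-+ {f} {g} f-mult g-mult {u} u∈ =
    resp (add (f-mult u∈) (g-mult u∈)) (λ y → ≈-sym (distribʳ (u y) (f y) (g y)))

  multiplier-* : ∀ {f g} → Multiplier f → Multiplier g → Multiplier (λ y → f y * g y)
  multiplier-* {f} {g} f-mult g-mult {u} u∈ = resp (f-mult (g-mult u∈)) (λ y → ≈-sym (*-assoc (f y) (g y) (u y)))

  multiplier-∏ : ∀ {m} (f : Fin m → Vec n) → (∀ j → Multiplier (f j)) → Multiplier (λ y → ∏ (λ j → f j y))
  multiplier-∏ {zero}  f f-mult = multiplier-const 1#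
  multiplier-∏ {suc m} f f-mult = multiplier-* (f-mult zero) (multiplier-∏ (f ∘ suc) (f-mult ∘ suc))

  multiplier-depth : ∀ i → Multiplier (λ y → [ depth y == i ])
  multiplier-depth = E*∈W₀

  -- In E*ᵢ A (g · E*ᵢ₊₁ A E*ᵢ u), the only path from y back to y goes down to a child and up again.
  children-path : ∀ (g u : Vec n) y z →
    [ adj y z ] * (g z * E* (suc (depth y)) (A (E* (depth y) u)) z) ≈ ([ isChild y z ] * g z) * u y
  children-path g u y z = begin
    [ adj y z ] * (g z * ([ dz ] * A (E* (depth y) u) z))   ≈⟨ *-congˡ (x∙yz≈y∙xz _ _ _) ⟩
    [ adj y z ] * ([ dz ] * (g z * A (E* (depth y) u) z))   ≈⟨ *-assoc _ _ _ ⟨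
    ([ adj y z ] * [ dz ]) * (g z * A (E* (depth y) u) z)   ≈⟨ *-congʳ ([∧] (adj y z) dz) ⟨
    [ isChild y z ] * (g z * A (E* (depth y) u) z)          ≈⟨ [b]*-guarded (λ yz → *-congˡ (A-E*-child yz)) ⟩
    [ isChild y z ] * (g z * u y)                           ≈⟨ *-assoc _ _ _ ⟨
    ([ isChild y z ] * g z) * u y                           ∎
    where
    dz = depth z == suc (depth y)
    A-E*-child : isChild y z ≡ true → A (E* (depth y) u) z ≈ u y
    A-E*-child yz = ≈-trans (A-single _ (Adj-sym zy) others) ([b]*≈ (u y) (dec-true (depth y ℕₚ.≟ depth y) refl))
      where
      zy = proj₁ (isChild⇒ yz)
      others : ∀ w → Adj Γ z w → w ≢ y → E* (depth y) u w ≈ 0#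
      others w zw w≢y = [b]*≈0 (u w) λ t → w≢y
        (parent-unique zw (Adj-sym zy) (trans (proj₂ (isChild⇒ yz)) (cong suc (sym (does⇒ (depth w ℕₚ.≟ depth y) t))))
                       (proj₂ (isChild⇒ yz)))

  multiplier-children : ∀ {g} → Multiplier g → Multiplier (λ y → sum (λ c → [ isChild y c ] * g c))
  multiplier-children {g} g-mult {u} u∈ =
    resp (sum-closed (InW₀ Γ x₀) zero∈ add {suc height} _ (λ i → term∈ (toℕ i))) value
    where
    term : ℕ → Vec n
    term i = A (λ z → g z * E* (suc i) (A (E* i u)) z)
    term∈ : ∀ i → InW₀ Γ x₀ (E* i (term i))
    term∈ i = E*∈W₀ i (applyA (g-mult (E*∈W₀ (suc i) (applyA (E*∈W₀ i u∈)))))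
    value : ∀ y → sum {suc height} (λ i → E* (toℕ i) (term (toℕ i)) y) ≈ sum (λ c → [ isChild y c ] * g c) * u y
    value y = begin
      sum {suc height} (λ i → E* (toℕ i) (term (toℕ i)) y)
                                                   ≈⟨ E*-levels term y ⟩
      term (depth y) y                             ≡⟨ ∑≡sum {n} _ ⟩
      sum (λ z → [ adj y z ] * (g z * E* (suc (depth y)) (A (E* (depth y) u)) z))
                                                   ≈⟨ sum-cong-≋ (children-path g u y) ⟩
      sum (λ c → ([ isChild y c ] * g c) * u y)    ≈⟨ *-distribʳ-sum (u y) (λ c → [ isChild y c ] * g c) ⟨
      sum (λ c → [ isChild y c ] * g c) * u y      ∎

  -- Lagrange interpolation: [N y == m] = ∏_{v ≤ M, v ≠ m} (N y - v) / (m - v), using that K has characteristic 0.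
  module Fibre (N : Fin n → ℕ) (M : ℕ) (N≤M : ∀ y → N y ≤ M) (N-mult : Multiplier (ℕ⟶K ∘ N)) (m : ℕ) where
    gap⁻¹ : ∀ v → v ≢ m → Carrier
    gap⁻¹ v v≢m = proj₁ (inverse (ℕ⟶K m - ℕ⟶K v) (ℕ⟶K-difference≉0 (v≢m ∘ sym)))

    factor : ℕ → Vec n
    factor v with v ℕₚ.≟ m
    ... | yes _  = λ _ → 1#
    ... | no v≢m = λ y → (ℕ⟶K (N y) - ℕ⟶K v) * gap⁻¹ v v≢m

    multiplier-factor : ∀ v → Multiplier (factor v)
    multiplier-factor v with v ℕₚ.≟ m
    ... | yes _ = multiplier-const 1#
    ... | no _  = multiplier-* (multiplier-+ N-mult (multiplier-const _)) (multiplier-const _)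

    factor-one : ∀ {y} → N y ≡ m → ∀ v → factor v y ≈ 1#
    factor-one {y} Ny≡m v with v ℕₚ.≟ m
    ... | yes _  = ≈-refl
    ... | no v≢m = ≈-trans (*-congʳ (+-congʳ (reflexive (cong ℕ⟶K Ny≡m))))
                           (proj₂ (inverse (ℕ⟶K m - ℕ⟶K v) (ℕ⟶K-difference≉0 (v≢m ∘ sym))))

    factor-zero : ∀ {y} → N y ≢ m → factor (N y) y ≈ 0#
    factor-zero {y} Ny≢m with N y ℕₚ.≟ m
    ... | yes Ny≡m = ⊥-elim (Ny≢m Ny≡m)
    ... | no _     = ≈-trans (*-congʳ (-‿inverseʳ (ℕ⟶K (N y)))) (zeroˡ _)

    multiplier-fibre : Multiplier (λ y → [ N y == m ])
    multiplier-fibre = multiplier-resp (multiplier-∏ {suc M} (factor ∘ toℕ) (multiplier-factor ∘ toℕ)) value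
      where
      value : ∀ y → ∏ {suc M} (λ v → factor (toℕ v) y) ≈ [ N y == m ]
      value y with N y ℕₚ.≟ m
      ... | yes Ny≡m = ≈-trans (∏-one {suc M} (λ v → factor (toℕ v) y) (factor-one Ny≡m ∘ toℕ))
                               (≈-sym ([true] (dec-true (N y ℕₚ.≟ m) Ny≡m)))
      ... | no Ny≢m  = ≈-trans (∏-zero {suc M} (λ v → factor (toℕ v) y) (fromℕ< (s≤s (N≤M y)))
        (≈-trans (reflexive (cong (λ v → factor v y) (Finₚ.toℕ-fromℕ< (s≤s (N≤M y))))) (factor-zero Ny≢m)))
        (≈-sym ([false] (Ny≢m ∘ does⇒ (N y ℕₚ.≟ m))))

  multiplier-similar : ∀ k x → Multiplier (λ y → [ similar k y x ])
  multiplier-similar zero    x = multiplier-depth (depth x)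
  multiplier-similar (suc k) x = multiplier-resp
    (multiplier-* (multiplier-depth (depth x)) (multiplier-∏ (λ j y → [ likeChildren k y j == likeChildren k x j ]) same-count))
    (λ y → ≈-sym (≈-trans ([∧] (depth y == depth x) (every λ j → likeChildren k y j == likeChildren k x j))
                                 (*-congˡ ([every] λ j → likeChildren k y j == likeChildren k x j))))
    where
    count-mult : ∀ j → Multiplier (λ y → ℕ⟶K (likeChildren k y j))
    count-mult j = multiplier-resp (multiplier-children (multiplier-similar k j))
      (λ y → ≈-sym (≈-trans (sum-count (λ c → isChild y c ∧ similar k c j))
                            (sum-cong-≋ (λ c → [∧] (isChild y c) (similar k c j)))))
    same-count : ∀ j → Multiplier (λ y → [ likeChildren k y j == likeChildren k x j ])
    same-count j = Fibre.multiplier-fibre (λ y → likeChildren k y j) n (λ y → count≤ _) (count-mult j) (likeChildren k x j)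

module PrincipalModule {c ℓ} (K : CharZeroField c ℓ) {n : ℕ} (Γ : SimpleGraph n) (x₀ : Fin n) (tree : IsTree Γ) where
  open CharZeroField K hiding (zero) renaming (refl to ≈-refl; sym to ≈-sym; trans to ≈-trans; setoid to ≈-setoid)
  open Standard K
  open FieldFacts K
  open Automorphisms Γ x₀
  open Tree Γ x₀ tree
  open Similarity Γ x₀ tree
  open Orbits Γ x₀ tree
  open Invariance K Γ x₀
  open Multipliers K Γ x₀ tree
  open Counting
  open import Relation.Binary.Reasoning.Setoid ≈-setoid

  classVec : Fin n → Vec n
  classVec x y = [ sameClass x y ]

  classVec-root : IsBasisVec Γ x₀ x₀ (classVec x₀)
  classVec-root y = (λ { refl → [true] (sameClass-refl x₀) }) ,
    (λ y≢x₀ → [false] λ p → y≢x₀ (depth⁰ (trans (sym (sameClass⇒depth p)) depth-root)))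

  A-classVec : ∀ {p y} → depth y ≡ suc (depth p) → A (classVec p) y ≈ classVec p (parent y)
  A-classVec {p} {y} dy = A-single (classVec p) (proj₁ (parent-spec dy)) others
    where
    others : ∀ z → Adj Γ y z → z ≢ parent y → classVec p z ≈ 0#
    others z yz z≢ = [false] λ pz → z≢ (parent-unique yz (proj₁ (parent-spec dy))
      (trans dy (cong suc (sameClass⇒depth pz))) (trans dy (cong suc (sym (proj₂ (parent-spec dy))))))

  classVec-step : ∀ {x k} → depth x ≡ suc k → ∀ y → [ similar (fuel x) y x ] * A (classVec (parent x)) y ≈ classVec x y
  classVec-step {x} {k} dx y = begin
    [ similar (fuel x) y x ] * A (classVec p) y         ≈⟨ [b]*-guarded (λ yx → A-classVec (dy yx)) ⟩
    [ similar (fuel x) y x ] * classVec p (parent y)    ≈⟨ [∧] (similar (fuel x) y x) (sameClass p (parent y)) ⟨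
    [ similar (fuel x) y x ∧ sameClass p (parent y) ]   ≡⟨ cong [_] (cong₂ _∧_ (similar-comm (fuel x) y x)
                                                                                (cong (λ t → lineage t p (parent y)) dp)) ⟩
    [ lineage (suc k) x y ]                             ≡⟨ cong (λ t → [ lineage t x y ]) (sym dx) ⟩
    classVec x y                                        ∎
    where
    p = parent x
    dp : depth p ≡ k
    dp = proj₂ (parent-spec dx)
    dy : similar (fuel x) y x ≡ true → depth y ≡ suc (depth p)
    dy yx = trans (similar⇒depth (fuel x) yx) (trans dx (cong suc (sym dp)))

  classVec∈W₀ : ∀ k x → depth x ≡ k → InW₀ Γ x₀ (classVec x)
  classVec∈W₀ zero    x dx = subst (InW₀ Γ x₀ ∘ classVec) (sym (depth⁰ dx)) (base _ classVec-root)
  classVec∈W₀ (suc k) x dx = resp (multiplier-similar (fuel x) x (applyA (classVec∈W₀ k (parent x) (proj₂ (parent-spec dx)))))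
                                  (classVec-step dx)

  orbit⇒sameClass : ∀ {x y} → SameOrbit Γ x₀ x y → sameClass x y ≡ true
  orbit⇒sameClass {x} {y} (h , hx≡y) with sameClass x y in xy
  ... | true  = refl
  ... | false = ⊥-elim (nontrivial (begin
    1#                  ≈⟨ [true] (sameClass-refl x) ⟨
    classVec x x        ≈⟨ W₀-invariant (classVec∈W₀ _ x refl) h x ⟨
    classVec x (to h x) ≡⟨ cong (classVec x) hx≡y ⟩
    classVec x y        ≈⟨ reflexive (cong [_] xy) ⟩
    0#                  ∎))

  classVec-orbit : ∀ x → IsOrbitVec Γ x₀ x (classVec x)
  classVec-orbit x y = (λ xy → [true] (orbit⇒sameClass xy)) , (λ ¬xy → [false] (¬xy ∘ sameClass⇒orbit))

  orbitVec-unique : ∀ {x u v} → IsOrbitVec Γ x₀ x u → IsOrbitVec Γ x₀ x v → ∀ y → u y ≈ v y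
  orbitVec-unique {x} u-x v-x y with sameClass x y in xy
  ... | true  = ≈-trans (proj₁ (u-x y) (sameClass⇒orbit xy)) (≈-sym (proj₁ (v-x y) (sameClass⇒orbit xy)))
  ... | false = ≈-trans (proj₂ (u-x y) ¬xy) (≈-sym (proj₂ (v-x y) ¬xy))
    where
    ¬xy : ¬ SameOrbit Γ x₀ x y
    ¬xy o with () ← trans (sym xy) (orbit⇒sameClass o)

  span⊆W₀ : ∀ {v} → InOrbitSpan Γ x₀ v → InW₀ Γ x₀ v
  span⊆W₀ (gen x v v-x)  = resp (classVec∈W₀ _ x refl) (orbitVec-unique (classVec-orbit x) v-x)
  span⊆W₀ zero∈          = zero∈
  span⊆W₀ (add u∈ v∈)    = add (span⊆W₀ u∈) (span⊆W₀ v∈)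
  span⊆W₀ (scale a u∈)   = scale a (span⊆W₀ u∈)
  span⊆W₀ (resp u∈ u≈v)  = resp (span⊆W₀ u∈) u≈v

  classSize : Fin n → ℕ
  classSize x = count (sameClass x)

  module _ {v : Vec n} (v-inv : Invariant v) where
    coefficient : Fin n → Carrier
    coefficient x = ℕ⟶K⁻¹ (classSize x) * v x

    coefficient-class : ∀ y x → coefficient x * classVec x y ≈ coefficient y * classVec y x
    coefficient-class y x with sameClass x y in xy
    ... | false = ≈-trans (zeroʳ _)
                          (≈-sym (≈-trans (*-congˡ (reflexive (cong [_] (trans (sameClass-comm y x) xy)))) (zeroʳ _)))
    ... | true  = *-cong (*-cong (reflexive (cong ℕ⟶K⁻¹ (count-cong (sameClass-resp xy)))) vx≈vy)
                         (≈-sym ([true] (sameClass-sym xy)))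
      where
      vx≈vy : v x ≈ v y
      vx≈vy with sameClass⇒orbit xy
      ... | h , hx≡y = ≈-trans (≈-sym (v-inv h x)) (reflexive (cong v hx≡y))

    class-expansion : ∀ y → sum (λ x → coefficient x * classVec x y) ≈ v y
    class-expansion y = begin
      sum (λ x → coefficient x * classVec x y)                 ≈⟨ sum-cong-≋ (coefficient-class y) ⟩
      sum (λ x → coefficient y * classVec y x)                 ≈⟨ *-distribˡ-sum (coefficient y) (classVec y) ⟨
      coefficient y * sum (classVec y)                         ≈⟨ *-congˡ (sum-count (sameClass y)) ⟨
      (ℕ⟶K⁻¹ (classSize y) * v y) * ℕ⟶K (classSize y)          ≈⟨ *-comm _ _ ⟩
      ℕ⟶K (classSize y) * (ℕ⟶K⁻¹ (classSize y) * v y)          ≈⟨ *-assoc _ _ _ ⟨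
      (ℕ⟶K (classSize y) * ℕ⟶K⁻¹ (classSize y)) * v y
        ≈⟨ *-congʳ (ℕ⟶K-inverse _ (count>0 _ y (sameClass-refl y))) ⟩
      1# * v y                                                 ≈⟨ *-identityˡ (v y) ⟩
      v y                                                      ∎

  W₀⊆span : ∀ {v} → InW₀ Γ x₀ v → InOrbitSpan Γ x₀ v
  W₀⊆span v∈ = resp (sum-closed (InOrbitSpan Γ x₀) zero∈ add _ (λ x → scale _ (gen x _ (classVec-orbit x))))
                    (class-expansion (W₀-invariant v∈))

theorem4 : ∀ {c ℓ} (K : CharZeroField c ℓ) {n : ℕ} (Γ : SimpleGraph n) (x₀ : Fin n) →
    IsTree Γ →
    ∀ (v : Standard.Vec K n) →
    (Standard.InW₀ K Γ x₀ v → Standard.InOrbitSpan K Γ x₀ v) ×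
    (Standard.InOrbitSpan K Γ x₀ v → Standard.InW₀ K Γ x₀ v)
theorem4 K Γ x₀ tree v = W₀⊆span , span⊆W₀
  where open PrincipalModule K Γ x₀ tree
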